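{- Every triply regular symmetric association scheme satisfies the 4-vertex condition.
   Context: A symmetric association scheme is a finite set $X$ with symmetric relations $R_0$ (identity),$R_1,\dots,R_d$ partitioning $X\times X$ such that for $(a,b)\in R_k$ the number of $c$ with $(a,c)\in R_i,(c,b)\in R_j$ depends only on $i,j,k$; its Bose–Mesner algebra $\mathbb A$ is spanned by the adjacency matrices of the $R_i$. It is triply regular if for all $x,y,z\in X$ and all $r,s,t$ the number of $w\in X$ with $(x,w)\in R_r,(y,w)\in R_s,(z,w)\in R_t$ depends only on $r,s,t$ and on the indices $i,j,k$ with $(y,z)\in R_i,(z,x)\in R_j,(x,y)\in R_k$. It satisfies the $t$-vertex condition if every second-order scaffold $\mathsf S(G,(r_1,r_2);w)=\sum_{\varphi:V(G)\to X}\big(\prod_{e=(a,b)\in E(G)}w(e)_{\varphi(a),\varphi(b)}\big)\widehat{\varphi(r_1)}\otimes\widehat{\varphi(r_2)}$, where $G$ is a finite digraph with at most $t$ nodes, $r_1,r_2$ are distinct nodes of $G$, and $w:E(G)\to\mathbb A$, belongs to $\mathbb A$ (identifying $\sum_{x,y}M_{xy}\hat x\otimes\hat y$ with the matrix $M$; $\{\hat x\}$ is the standard basis of $\mathbb C^X$). -}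

module Defs where

open import Level using (Level)
open import Data.Nat using (ℕ; zero; suc; _≤_)
open import Data.Fin using (Fin; zero; suc; _≟_)
open import Data.Bool using (Bool; true; false; if_then_else_; _∧_)
open import Data.Product using (Σ; ∃; ∃-syntax; _×_; _,_)
open import Data.Vec.Functional using (_∷_)
open import Relation.Nullary.Decidable using (⌊_⌋)
open import Relation.Binary.PropositionalEquality using (_≡_; _≢_)
open import Algebra.Bundles using (CommutativeRing)

count : ∀ {n} → (Fin n → Bool) → ℕ
count {zero}  P = 0
count {suc n} P = (if P zero then 1 else 0) Data.Nat.+ count (λ i → P (suc i))

-- A symmetric association scheme on X = Fin n with classes 0..d.
-- rel x y = i  means (x,y) ∈ R_i.
record SymAssocScheme (n d : ℕ) : Set where
  field
    rel       : Fin n → Fin n → Fin (suc d)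
    rel-zero  : ∀ x y → (rel x y ≡ zero → x ≡ y) × (x ≡ y → rel x y ≡ zero)
    rel-sym   : ∀ x y → rel x y ≡ rel y x
    rel-nonempty : ∀ i → ∃[ x ] ∃[ y ] rel x y ≡ i
    p         : Fin (suc d) → Fin (suc d) → Fin (suc d) → ℕ
    p-spec    : ∀ a b i j →
                count (λ c → ⌊ rel a c ≟ i ⌋ ∧ ⌊ rel c b ≟ j ⌋) ≡ p i j (rel a b)

open SymAssocScheme public

TriplyRegular : ∀ {n d} → SymAssocScheme n d → Set
TriplyRegular {n} {d} S =
  Σ (Fin (suc d) → Fin (suc d) → Fin (suc d) →
     Fin (suc d) → Fin (suc d) → Fin (suc d) → ℕ) λ q →
    ∀ (x y z : Fin n) (r s t : Fin (suc d)) →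
      count (λ w → ⌊ rel S x w ≟ r ⌋ ∧ ⌊ rel S y w ≟ s ⌋ ∧ ⌊ rel S z w ≟ t ⌋)
        ≡ q r s t (rel S y z) (rel S z x) (rel S x y)

module OverRing {c ℓ : Level} (K : CommutativeRing c ℓ) where
  open CommutativeRing K using (Carrier; _≈_; _+_; _*_; 0#; 1#)

  Matrix : ℕ → Set c
  Matrix n = Fin n → Fin n → Carrier

  ∑ : ∀ {n} → (Fin n → Carrier) → Carrier
  ∑ {zero}  f = 0#
  ∑ {suc n} f = f zero + ∑ (λ i → f (suc i))

  ∏ : ∀ {m} → (Fin m → Carrier) → Carrier
  ∏ {zero}  f = 1#
  ∏ {suc m} f = f zero * ∏ (λ i → f (suc i))

  ∑Maps : ∀ {n} k → ((Fin k → Fin n) → Carrier) → Carrier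
  ∑Maps zero    F = F (λ ())
  ∑Maps (suc k) F = ∑ (λ x → ∑Maps k (λ φ → F (x ∷ φ)))

  adj : ∀ {n d} → SymAssocScheme n d → Fin (suc d) → Matrix n
  adj S i x y = if ⌊ rel S x y ≟ i ⌋ then 1# else 0#

  InBM : ∀ {n d} → SymAssocScheme n d → Matrix n → Set (c Level.⊔ ℓ)
  InBM {n} {d} S M = Σ (Fin (suc d) → Carrier) λ a →
    ∀ x y → M x y ≈ ∑ (λ i → a i * adj S i x y)

  record Digraph (k : ℕ) : Set where
    field
      nEdges : ℕ
      edge   : Fin nEdges → Fin k × Fin k

  open Digraph public

  -- second-order scaffold S(G,(r₁,r₂);w), as the matrix whose (x,y)-entry is
  -- the coefficient of x̂ ⊗ ŷ
  scaffold : ∀ {n k} (G : Digraph k) (r₁ r₂ : Fin k) →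
             (Fin (nEdges G) → Matrix n) → Matrix n
  scaffold {n} {k} G r₁ r₂ w x y =
    ∑Maps k (λ φ →
      if ⌊ φ r₁ ≟ x ⌋ ∧ ⌊ φ r₂ ≟ y ⌋
      then ∏ (λ e → w e (φ (Data.Product.proj₁ (edge G e)))
                        (φ (Data.Product.proj₂ (edge G e))))
      else 0#)

  VertexCondition : ∀ {n d} → ℕ → SymAssocScheme n d → Set (c Level.⊔ ℓ)
  VertexCondition {n} {d} t S =
    ∀ (k : ℕ) → k ≤ t → (G : Digraph k) (r₁ r₂ : Fin k) → r₁ ≢ r₂ →
    (w : Fin (nEdges G) → Matrix n) → (∀ e → InBM S (w e)) →
    InBM S (scaffold G r₁ r₂ w)

-- Call a function of tuples of points invariant if it depends only on the
-- relations among the points.  Triple regularity says that for two or three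
-- fixed points the number of points w with prescribed relations to them depends
-- only on the relations among the fixed points.  Splitting a sum over w by these
-- relations shows that summing an invariant function over one point, with two or
-- three others fixed, again gives an invariant function.  The (x, y) entry of a
-- scaffold with at most four nodes is a sum, over the at most two non-root nodes,
-- of an invariant product of Bose–Mesner entries; summing those nodes out one at
-- a time leaves a function of (x, y) that depends only on the relation between
-- x and y, i.e. a matrix of the Bose–Mesner algebra.

module Submission where

open import Defs
open import Level using (Level)
open import Data.Nat as ℕ using (ℕ; zero; suc; _≤_; _<_; s≤s; z≤n)
open import Data.Nat.Properties using (+-suc; <-≤-trans)
open import Data.Fin using (Fin; zero; suc; _≟_; punchIn; punchOut)
open import Data.Fin.Patterns using (0F; 1F; 2F)
open import Data.Fin.Properties using (punchIn-punchOut; suc-injective)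
open import Data.Bool using (Bool; true; false; if_then_else_; _∧_)
open import Data.Bool.Properties using (∧-identityʳ; ∧-idem; ∧-assoc)
open import Data.Product using (∃; _,_; proj₁; proj₂)
open import Data.Empty using (⊥-elim)
open import Data.Sum using (_⊎_; inj₁; inj₂; [_,_])
open import Data.Vec.Functional using (_∷_; []; foldr)
open import Function using (_∘_)
open import Relation.Nullary using (yes; no)
open import Relation.Nullary.Decidable using (⌊_⌋)
open import Relation.Binary.PropositionalEquality
  using (_≡_; _≢_; _≗_; refl; sym; trans; cong; cong₂; subst; module ≡-Reasoning)
open import Algebra.Bundles using (CommutativeRing)
import Relation.Binary.Reasoning.Setoid

count-cong : ∀ {n} {Q Q′ : Fin n → Bool} → Q ≗ Q′ → count Q ≡ count Q′
count-cong {zero}  eq = refl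
count-cong {suc n} eq = cong₂ (λ b k → (if b then 1 else 0) ℕ.+ k) (eq zero) (count-cong (eq ∘ suc))

count≡0⇒false : ∀ {n} (Q : Fin n → Bool) → count Q ≡ 0 → ∀ w → Q w ≡ false
count≡0⇒false {suc n} Q eq w with Q zero in Q₀
count≡0⇒false Q eq zero    | false = Q₀
count≡0⇒false Q eq (suc w) | false = count≡0⇒false (Q ∘ suc) eq w

count≡suc⇒∃true : ∀ {n} (Q : Fin n → Bool) {k} → count Q ≡ suc k → ∃ λ w → Q w ≡ true
count≡suc⇒∃true {suc n} Q eq with Q zero in Q₀
... | true  = zero , Q₀
... | false = let w , Qw = count≡suc⇒∃true (Q ∘ suc) eq in suc w , Qw

agree : ∀ {m c} → (Fin m → Fin c) → (Fin m → Fin c) → Bool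
agree t τ = foldr _∧_ true (λ a → ⌊ t a ≟ τ a ⌋)

agree-sound : ∀ {m c} (t τ : Fin m → Fin c) → agree t τ ≡ true → ∀ a → t a ≡ τ a
agree-sound {suc m} t τ eq a with t zero ≟ τ zero
agree-sound t τ eq zero    | yes t₀≡τ₀ = t₀≡τ₀
agree-sound t τ eq (suc a) | yes _     = agree-sound (t ∘ suc) (τ ∘ suc) eq a
agree-sound t τ () a       | no _

-- Unlike insertAt of Data.Vec.Functional, this reduces to _∷_ definitionally,
-- so sums over maps can be reorganised around it without extensionality.
insert : ∀ {A : Set} {k} → Fin (suc k) → A → (Fin k → A) → Fin (suc k) → A
insert zero               x φ = x ∷ φ
insert {k = suc k} (suc i) x φ = φ zero ∷ insert i x (φ ∘ suc)

insert-self : ∀ {A : Set} {k} (i : Fin (suc k)) (x : A) φ → insert i x φ i ≡ x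
insert-self zero               x φ = refl
insert-self {k = suc k} (suc i) x φ = insert-self i x (φ ∘ suc)

insert-punchIn : ∀ {A : Set} {k} (i : Fin (suc k)) (x : A) φ j → insert i x φ (punchIn i j) ≡ φ j
insert-punchIn zero    x φ j       = refl
insert-punchIn (suc i) x φ zero    = refl
insert-punchIn (suc i) x φ (suc j) = insert-punchIn i x (φ ∘ suc) j

insert-map : ∀ {A B : Set} {k} (f : A → B) (i : Fin (suc k)) x {φ : Fin k → A} {φ′ : Fin k → B} →
             φ′ ≗ f ∘ φ → insert i (f x) φ′ ≗ f ∘ insert i x φ
insert-map f zero              x eq zero    = refl
insert-map f zero              x eq (suc a) = eq a
insert-map {k = suc k} f (suc i) x eq zero    = eq zero
insert-map {k = suc k} f (suc i) x eq (suc a) = insert-map f i x (eq ∘ suc) a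

insert-punchOut : ∀ {A : Set} {k} {i j : Fin (suc k)} (i≢j : i ≢ j) (x : A) φ →
                  insert i x φ j ≡ φ (punchOut i≢j)
insert-punchOut {i = i} i≢j x φ =
  trans (cong (insert i x φ) (sym (punchIn-punchOut i≢j))) (insert-punchIn i x φ (punchOut i≢j))

-- Puts χ (inj₂ 0F) at r₁, χ (inj₂ 1F) at r₂ and χ ∘ inj₁, in order, at the other nodes.
place : ∀ {A : Set} {j} {r₁ r₂ : Fin (suc (suc j))} → r₁ ≢ r₂ →
        (Fin j ⊎ Fin 2 → A) → Fin (suc (suc j)) → A
place {r₁ = r₁} r₁≢r₂ χ = insert r₁ (χ (inj₂ 0F)) (insert (punchOut r₁≢r₂) (χ (inj₂ 1F)) (χ ∘ inj₁))

place-natural : ∀ {A B : Set} {j} {r₁ r₂ : Fin (suc (suc j))} (r₁≢r₂ : r₁ ≢ r₂) (f : A → B) χ →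
                place r₁≢r₂ (f ∘ χ) ≗ f ∘ place r₁≢r₂ χ
place-natural {r₁ = r₁} r₁≢r₂ f χ =
  insert-map f r₁ _ (insert-map f (punchOut r₁≢r₂) _ (λ _ → refl))

module Sums {c ℓ : Level} (K : CommutativeRing c ℓ) where
  open OverRing K
  open CommutativeRing K
    using (Carrier; _≈_; _+_; 0#; +-cong; +-congˡ; *-cong; +-identityˡ; +-identityʳ;
           setoid; +-commutativeSemigroup; +-rawMonoid)
    renaming (refl to ≈-refl; sym to ≈-sym; trans to ≈-trans)
  open import Algebra.Properties.CommutativeSemigroup +-commutativeSemigroup using (interchange)
  open import Algebra.Definitions.RawMonoid +-rawMonoid using (_×_)
  open Relation.Binary.Reasoning.Setoid setoid
  open import Relation.Binary.PropositionalEquality as ≡ using ()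

  ≡⇒≈ : ∀ {x y} → x ≡ y → x ≈ y
  ≡⇒≈ refl = ≈-refl

  ∑-cong : ∀ {m} {f g : Fin m → Carrier} → (∀ i → f i ≈ g i) → ∑ f ≈ ∑ g
  ∑-cong {zero}  eq = ≈-refl
  ∑-cong {suc m} eq = +-cong (eq zero) (∑-cong (eq ∘ suc))

  ∑-zero : ∀ {m} {f : Fin m → Carrier} → (∀ i → f i ≈ 0#) → ∑ f ≈ 0#
  ∑-zero {zero}  eq = ≈-refl
  ∑-zero {suc m} eq = ≈-trans (+-cong (eq zero) (∑-zero (eq ∘ suc))) (+-identityˡ 0#)

  ∑-distrib-+ : ∀ {m} (f g : Fin m → Carrier) → ∑ (λ i → f i + g i) ≈ ∑ f + ∑ g
  ∑-distrib-+ {zero}  f g = ≈-sym (+-identityˡ 0#)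
  ∑-distrib-+ {suc m} f g =
    ≈-trans (+-congˡ (∑-distrib-+ (f ∘ suc) (g ∘ suc))) (interchange (f zero) (g zero) _ _)

  ∑-comm : ∀ {a b} (f : Fin a → Fin b → Carrier) →
           ∑ (λ i → ∑ (λ j → f i j)) ≈ ∑ (λ j → ∑ (λ i → f i j))
  ∑-comm {zero} {b} f = ≈-sym (∑-zero {b} (λ _ → ≈-refl))
  ∑-comm {suc a} f = ≈-trans (+-congˡ (∑-comm (f ∘ suc))) (≈-sym (∑-distrib-+ (f zero) _))

  ∑-pick : ∀ {m} (f : Fin m → Carrier) i → (∀ j → j ≢ i → f j ≈ 0#) → ∑ f ≈ f i
  ∑-pick f zero    off = ≈-trans (+-congˡ (∑-zero (λ j → off (suc j) λ ()))) (+-identityʳ _)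
  ∑-pick f (suc i) off =
    ≈-trans (+-cong (off zero λ ()) (∑-pick (f ∘ suc) i λ j j≢i → off (suc j) (j≢i ∘ suc-injective)))
            (+-identityˡ _)

  ∏-cong : ∀ {m} {f g : Fin m → Carrier} → (∀ i → f i ≈ g i) → ∏ f ≈ ∏ g
  ∏-cong {zero}  eq = ≈-refl
  ∏-cong {suc m} eq = *-cong (eq zero) (∏-cong (eq ∘ suc))

  ∑Maps-cong : ∀ {b} k {F G : (Fin k → Fin b) → Carrier} → (∀ φ → F φ ≈ G φ) →
               ∑Maps k F ≈ ∑Maps k G
  ∑Maps-cong zero    eq = eq _
  ∑Maps-cong (suc k) eq = ∑-cong (λ x → ∑Maps-cong k (λ φ → eq (x ∷ φ)))

  ∑Maps-zero : ∀ {b} k {F : (Fin k → Fin b) → Carrier} → (∀ φ → F φ ≈ 0#) → ∑Maps k F ≈ 0#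
  ∑Maps-zero zero    eq = eq _
  ∑Maps-zero (suc k) eq = ∑-zero (λ x → ∑Maps-zero k (λ φ → eq (x ∷ φ)))

  ∑-∑Maps-comm : ∀ {a b} k (F : Fin a → (Fin k → Fin b) → Carrier) →
                 ∑ (λ w → ∑Maps k (F w)) ≈ ∑Maps k (λ φ → ∑ (λ w → F w φ))
  ∑-∑Maps-comm zero    F = ≈-refl
  ∑-∑Maps-comm (suc k) F =
    ≈-trans (∑-comm (λ w x → ∑Maps k (λ φ → F w (x ∷ φ))))
            (∑-cong (λ x → ∑-∑Maps-comm k (λ w φ → F w (x ∷ φ))))

  ∑Maps-agree : ∀ {b} m (t : Fin m → Fin b) (v : Carrier) →
                ∑Maps m (λ τ → if agree t τ then v else 0#) ≈ v
  ∑Maps-agree zero    t v = ≈-refl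
  ∑Maps-agree (suc m) t v = ≈-trans (∑-pick _ (t zero) off) on
    where
    off : ∀ x → x ≢ t zero →
          ∑Maps m (λ τ → if ⌊ t zero ≟ x ⌋ ∧ agree (t ∘ suc) τ then v else 0#) ≈ 0#
    off x x≢t₀ with t zero ≟ x
    ... | yes t₀≡x = ⊥-elim (x≢t₀ (≡.sym t₀≡x))
    ... | no _     = ∑Maps-zero m (λ _ → ≈-refl)
    on : ∑Maps m (λ τ → if ⌊ t zero ≟ t zero ⌋ ∧ agree (t ∘ suc) τ then v else 0#) ≈ v
    on with t zero ≟ t zero
    ... | yes _    = ∑Maps-agree m (t ∘ suc) v
    ... | no t₀≢t₀ = ⊥-elim (t₀≢t₀ refl)

  ∑-partition : ∀ {a b} m (t : Fin a → Fin m → Fin b) (g : Fin a → Carrier) →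
                ∑ g ≈ ∑Maps m (λ τ → ∑ (λ w → if agree (t w) τ then g w else 0#))
  ∑-partition m t g =
    ≈-trans (∑-cong (λ w → ≈-sym (∑Maps-agree m (t w) (g w))))
            (∑-∑Maps-comm m (λ w τ → if agree (t w) τ then g w else 0#))

  ∑-if-≈-count : ∀ {m} (Q : Fin m → Bool) {g : Fin m → Carrier} {v} →
                 (∀ w → Q w ≡ true → g w ≈ v) → ∑ (λ w → if Q w then g w else 0#) ≈ count Q × v
  ∑-if-≈-count {zero}  Q on = ≈-refl
  ∑-if-≈-count {suc m} Q on with Q zero in Q₀
  ... | true  = +-cong (on zero Q₀) (∑-if-≈-count (Q ∘ suc) (on ∘ suc))
  ... | false = ≈-trans (+-identityˡ _) (∑-if-≈-count (Q ∘ suc) (on ∘ suc))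

  ∑-if-false : ∀ {m} {Q : Fin m → Bool} {g : Fin m → Carrier} →
               (∀ w → Q w ≡ false) → ∑ (λ w → if Q w then g w else 0#) ≈ 0#
  ∑-if-false {g = g} off = ∑-zero (λ w → ≡⇒≈ (≡.cong (λ b → if b then g w else 0#) (off w)))

  ∑-if-equinumerous : ∀ {m} (Q Q′ : Fin m → Bool) {g g′ : Fin m → Carrier} →
                      count Q ≡ count Q′ → (∀ w w′ → Q w ≡ true → Q′ w′ ≡ true → g w ≈ g′ w′) →
                      ∑ (λ w → if Q w then g w else 0#) ≈ ∑ (λ w → if Q′ w then g′ w else 0#)
  ∑-if-equinumerous Q Q′ {g} {g′} same link = by-count (count Q) ≡.refl
    where
    by-count : ∀ k → count Q ≡ k →
               ∑ (λ w → if Q w then g w else 0#) ≈ ∑ (λ w → if Q′ w then g′ w else 0#)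
    by-count zero eq = ≈-trans (∑-if-false (count≡0⇒false Q eq))
                               (≈-sym (∑-if-false (count≡0⇒false Q′ (≡.trans (≡.sym same) eq))))
    by-count (suc _) eq with count≡suc⇒∃true Q eq | count≡suc⇒∃true Q′ (≡.trans (≡.sym same) eq)
    ... | w₀ , Qw₀ | w₁ , Q′w₁ = begin
      ∑ (λ w → if Q w then g w else 0#)
        ≈⟨ ∑-if-≈-count Q (λ w Qw → ≈-trans (link w w₁ Qw Q′w₁) (≈-sym (link w₀ w₁ Qw₀ Q′w₁))) ⟩
      count Q × g w₀
        ≡⟨ ≡.cong (_× g w₀) same ⟩
      count Q′ × g w₀
        ≈⟨ ∑-if-≈-count Q′ (λ w′ Q′w′ → ≈-sym (link w₀ w′ Qw₀ Q′w′)) ⟨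
      ∑ (λ w → if Q′ w then g′ w else 0#) ∎

  ∑Maps-insert : ∀ {b} k (i : Fin (suc k)) (F : (Fin (suc k) → Fin b) → Carrier) →
                 ∑Maps (suc k) F ≈ ∑ (λ x → ∑Maps k (λ φ → F (insert i x φ)))
  ∑Maps-insert k       zero    F = ≈-refl
  ∑Maps-insert (suc k) (suc i) F =
    ≈-trans (∑-cong (λ y → ∑Maps-insert k i (λ φ → F (y ∷ φ))))
            (∑-comm (λ y x → ∑Maps k (λ φ → F (y ∷ insert i x φ))))

  ∑Maps-pin : ∀ {b} k (i : Fin (suc k)) (x : Fin b) {F : (Fin (suc k) → Fin b) → Carrier} →
              (∀ φ → φ i ≢ x → F φ ≈ 0#) → ∑Maps (suc k) F ≈ ∑Maps k (λ φ → F (insert i x φ))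
  ∑Maps-pin k i x {F} off = ≈-trans (∑Maps-insert k i F) (∑-pick _ x vanish)
    where
    vanish : ∀ y → y ≢ x → ∑Maps k (λ φ → F (insert i y φ)) ≈ 0#
    vanish y y≢x = ∑Maps-zero k (λ φ → off _ (y≢x ∘ ≡.trans (≡.sym (insert-self i y φ))))

module Scheme {c ℓ : Level} (K : CommutativeRing c ℓ) {n d : ℕ} (S : SymAssocScheme n d) where
  open OverRing K
  open Sums K
  open CommutativeRing K
    using (Carrier; _≈_; _*_; 0#; *-identityʳ; zeroʳ; setoid)
    renaming (refl to ≈-refl; sym to ≈-sym; trans to ≈-trans)
  module ≈-Reasoning = Relation.Binary.Reasoning.Setoid setoid

  infix 4 _∼_
  _∼_ : ∀ {I : Set} → (I → Fin n) → (I → Fin n) → Set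
  α ∼ β = ∀ a b → rel S (α a) (α b) ≡ rel S (β a) (β b)

  Invariant : ∀ {I : Set} → ((I → Fin n) → Carrier) → Set ℓ
  Invariant F = ∀ {α β} → α ∼ β → F α ≈ F β

  ≗⇒∼ : ∀ {I : Set} {α β : I → Fin n} → α ≗ β → α ∼ β
  ≗⇒∼ eq a b = cong₂ (rel S) (eq a) (eq b)

  ∼-reindex : ∀ {I J : Set} (ρ : I → J) {α β : I → Fin n} {γ δ : J → Fin n} →
              α ≗ γ ∘ ρ → β ≗ δ ∘ ρ → γ ∼ δ → α ∼ β
  ∼-reindex ρ α≗γρ β≗δρ γ∼δ a b =
    trans (≗⇒∼ α≗γρ a b) (trans (γ∼δ (ρ a) (ρ b)) (sym (≗⇒∼ β≗δρ a b)))

  rel-diag : ∀ x → rel S x x ≡ zero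
  rel-diag x = proj₂ (rel-zero S x x) refl

  ∷-∼ : ∀ {m} {α β : Fin m → Fin n} {x y} → α ∼ β → (∀ a → rel S (α a) x ≡ rel S (β a) y) →
        (x ∷ α) ∼ (y ∷ β)
  ∷-∼ {x = x} {y} α∼β eq zero    zero    = trans (rel-diag x) (sym (rel-diag y))
  ∷-∼ {α = α} {β} {x} {y} α∼β eq zero (suc b) =
    trans (rel-sym S x (α b)) (trans (eq b) (rel-sym S (β b) y))
  ∷-∼ α∼β eq (suc a) zero    = eq a
  ∷-∼ α∼β eq (suc a) (suc b) = α∼β a b

  pair-∼ : ∀ {x y x′ y′} → rel S x y ≡ rel S x′ y′ → (x ∷ y ∷ []) ∼ (x′ ∷ y′ ∷ [])
  pair-∼ {y = y} {y′ = y′} eq = ∷-∼ (λ { zero zero → trans (rel-diag y) (sym (rel-diag y′)) })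
                                    (λ { zero → trans (rel-sym S y _) (trans eq (rel-sym S _ y′)) })

  ∑-adj : ∀ (f : Fin (suc d) → Carrier) x y → ∑ (λ i → f i * adj S i x y) ≈ f (rel S x y)
  ∑-adj f x y = ≈-trans (∑-pick _ (rel S x y) off) on
    where
    off : ∀ i → i ≢ rel S x y → f i * adj S i x y ≈ 0#
    off i i≢r with rel S x y ≟ i
    ... | yes r≡i = ⊥-elim (i≢r (sym r≡i))
    ... | no _    = zeroʳ (f i)
    on : f (rel S x y) * adj S (rel S x y) x y ≈ f (rel S x y)
    on with rel S x y ≟ rel S x y
    ... | yes _   = *-identityʳ _
    ... | no r≢r  = ⊥-elim (r≢r refl)

  InBM-entry : ∀ {M} → InBM S M → ∀ {x y x′ y′} → rel S x y ≡ rel S x′ y′ → M x y ≈ M x′ y′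
  InBM-entry (a , M≈) {x} {y} {x′} {y′} eq =
    ≈-trans (M≈ x y) (≈-trans (∑-adj a x y)
      (≈-trans (≡⇒≈ (cong a eq)) (≈-sym (≈-trans (M≈ x′ y′) (∑-adj a x′ y′)))))

  invariant⇒InBM : ∀ {M : Matrix n} → Invariant (λ ψ → M (ψ zero) (ψ (suc zero))) → InBM S M
  invariant⇒InBM {M} inv = coeff , λ x y → ≈-trans (entry x y) (≈-sym (∑-adj coeff x y))
    where
    coeff : Fin (suc d) → Carrier
    coeff i = let x , y , _ = rel-nonempty S i in M x y
    entry : ∀ x y → M x y ≈ coeff (rel S x y)
    entry x y = let _ , _ , eq = rel-nonempty S (rel S x y) in inv (pair-∼ (sym eq))

  weight : ∀ {k} (G : Digraph k) → (Fin (nEdges G) → Matrix n) → (Fin k → Fin n) → Carrier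
  weight G w φ = ∏ (λ e → w e (φ (proj₁ (edge G e))) (φ (proj₂ (edge G e))))

  weight-invariant : ∀ {k} (G : Digraph k) {w} → (∀ e → InBM S (w e)) → Invariant (weight G w)
  weight-invariant G w∈BM α∼β =
    ∏-cong (λ e → InBM-entry (w∈BM e) (α∼β (proj₁ (edge G e)) (proj₂ (edge G e))))

  profile : ∀ {m} → (Fin m → Fin n) → Fin n → Fin m → Fin (suc d)
  profile ψ w a = rel S (ψ a) w

  Regular : ℕ → Set
  Regular m = ∀ {ψ ψ′ : Fin m → Fin n} → ψ ∼ ψ′ →
              ∀ τ → count (λ w → agree (profile ψ w) τ) ≡ count (λ w → agree (profile ψ′ w) τ)

  ∑-head-invariant : ∀ {m} → Regular m → {H : (Fin (suc m) → Fin n) → Carrier} → Invariant H →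
                     Invariant (λ ψ → ∑ (λ w → H (w ∷ ψ)))
  ∑-head-invariant {m} reg {H} inv {ψ} {ψ′} ψ∼ψ′ = begin
    ∑ (λ w → H (w ∷ ψ))
      ≈⟨ ∑-partition m (profile ψ) _ ⟩
    ∑Maps m (λ τ → ∑ (λ w → if agree (profile ψ w) τ then H (w ∷ ψ) else 0#))
      ≈⟨ ∑Maps-cong m (λ τ → ∑-if-equinumerous _ _ (reg ψ∼ψ′ τ) same-class) ⟩
    ∑Maps m (λ τ → ∑ (λ w → if agree (profile ψ′ w) τ then H (w ∷ ψ′) else 0#))
      ≈⟨ ∑-partition m (profile ψ′) _ ⟨
    ∑ (λ w → H (w ∷ ψ′)) ∎
    where
    open ≈-Reasoning
    same-class : ∀ {τ} w w′ → agree (profile ψ w) τ ≡ true → agree (profile ψ′ w′) τ ≡ true →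
                 H (w ∷ ψ) ≈ H (w′ ∷ ψ′)
    same-class w w′ ψw∈τ ψ′w′∈τ = inv (∷-∼ ψ∼ψ′ λ a →
      trans (agree-sound _ _ ψw∈τ a) (sym (agree-sound _ _ ψ′w′∈τ a)))

  ∑Maps-invariant : ∀ j {m} → (∀ i → i < j → Regular (i ℕ.+ m)) →
                    {H : (Fin j ⊎ Fin m → Fin n) → Carrier} → Invariant H →
                    Invariant (λ ψ → ∑Maps j (λ φ → H [ φ , ψ ]))
  ∑Maps-invariant zero reg inv ψ∼ψ′ = inv λ where
    (inj₂ a) (inj₂ b) → ψ∼ψ′ a b
  ∑Maps-invariant (suc j) {m} reg {H} inv {ψ} {ψ′} ψ∼ψ′ = begin
    ∑ (λ x → ∑Maps j (λ φ → H [ x ∷ φ , ψ ]))   ≈⟨ move-head-∑ ψ ⟩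
    ∑ (λ x → G (x ∷ ψ))                         ≈⟨ ∑-head-invariant (reg 0 (s≤s z≤n)) G-invariant ψ∼ψ′ ⟩
    ∑ (λ x → G (x ∷ ψ′))                        ≈⟨ move-head-∑ ψ′ ⟨
    ∑ (λ x → ∑Maps j (λ φ → H [ x ∷ φ , ψ′ ])) ∎
    where
    open ≈-Reasoning
    shift : Fin (suc j) ⊎ Fin m → Fin j ⊎ Fin (suc m)
    shift (inj₁ zero)    = inj₂ zero
    shift (inj₁ (suc a)) = inj₁ a
    shift (inj₂ b)       = inj₂ (suc b)
    move-head : ∀ x φ (ψ : Fin m → Fin n) → [ x ∷ φ , ψ ] ≗ [ φ , x ∷ ψ ] ∘ shift
    move-head x φ ψ (inj₁ zero)    = refl
    move-head x φ ψ (inj₁ (suc a)) = refl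
    move-head x φ ψ (inj₂ b)       = refl
    G : (Fin (suc m) → Fin n) → Carrier
    G χ = ∑Maps j (λ φ → H ([ φ , χ ] ∘ shift))
    move-head-∑ : ∀ χ → ∑ (λ x → ∑Maps j (λ φ → H [ x ∷ φ , χ ])) ≈ ∑ (λ x → G (x ∷ χ))
    move-head-∑ χ = ∑-cong (λ x → ∑Maps-cong j (λ φ → inv (≗⇒∼ (move-head x φ χ))))
    G-invariant : Invariant G
    G-invariant = ∑Maps-invariant j
      (λ i i<j → subst Regular (sym (+-suc i m)) (reg (suc i) (s≤s i<j)))
      (λ α∼β → inv (λ a b → α∼β (shift a) (shift b)))

  module _ (triply : TriplyRegular S) where
    private
      q = proj₁ triply

    regular₃ : Regular 3
    regular₃ {ψ} {ψ′} ψ∼ψ′ τ = begin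
      count (λ w → agree (profile ψ w) τ)     ≡⟨ count-cong (drop-true ψ) ⟩
      count (triple ψ)                        ≡⟨ proj₂ triply (ψ 0F) (ψ 1F) (ψ 2F) (τ 0F) (τ 1F) (τ 2F) ⟩
      q (τ 0F) (τ 1F) (τ 2F) (rel S (ψ 1F) (ψ 2F)) (rel S (ψ 2F) (ψ 0F)) (rel S (ψ 0F) (ψ 1F))
        ≡⟨ q-cong (ψ∼ψ′ 1F 2F) (ψ∼ψ′ 2F 0F) (ψ∼ψ′ 0F 1F) ⟩
      q (τ 0F) (τ 1F) (τ 2F) (rel S (ψ′ 1F) (ψ′ 2F)) (rel S (ψ′ 2F) (ψ′ 0F)) (rel S (ψ′ 0F) (ψ′ 1F))
        ≡⟨ proj₂ triply (ψ′ 0F) (ψ′ 1F) (ψ′ 2F) (τ 0F) (τ 1F) (τ 2F) ⟨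
      count (triple ψ′)                       ≡⟨ count-cong (drop-true ψ′) ⟨
      count (λ w → agree (profile ψ′ w) τ)    ∎
      where
      open ≡-Reasoning
      q-cong : ∀ {a a′ b b′ e e′} → a ≡ a′ → b ≡ b′ → e ≡ e′ →
               q (τ 0F) (τ 1F) (τ 2F) a b e ≡ q (τ 0F) (τ 1F) (τ 2F) a′ b′ e′
      q-cong refl refl refl = refl
      triple : (Fin 3 → Fin n) → Fin n → Bool
      triple χ w = ⌊ rel S (χ 0F) w ≟ τ 0F ⌋ ∧ ⌊ rel S (χ 1F) w ≟ τ 1F ⌋ ∧ ⌊ rel S (χ 2F) w ≟ τ 2F ⌋
      drop-true : ∀ χ → (λ w → agree (profile χ w) τ) ≗ triple χ
      drop-true χ w = cong (λ b → ⌊ rel S (χ 0F) w ≟ τ 0F ⌋ ∧ ⌊ rel S (χ 1F) w ≟ τ 1F ⌋ ∧ b)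
                           (∧-identityʳ _)

    regular₂ : Regular 2
    regular₂ {ψ} {ψ′} ψ∼ψ′ τ = begin
      count (λ w → agree (profile ψ w) τ)               ≡⟨ count-cong (repeat ψ) ⟩
      count (λ w → agree (profile (ψ ∘ ρ) w) (τ ∘ ρ))   ≡⟨ regular₃ (λ a b → ψ∼ψ′ (ρ a) (ρ b)) (τ ∘ ρ) ⟩
      count (λ w → agree (profile (ψ′ ∘ ρ) w) (τ ∘ ρ))  ≡⟨ count-cong (repeat ψ′) ⟨
      count (λ w → agree (profile ψ′ w) τ)              ∎
      where
      open ≡-Reasoning
      ρ : Fin 3 → Fin 2
      ρ = 0F ∷ 1F ∷ 1F ∷ []
      repeat : ∀ χ → (λ w → agree (profile χ w) τ) ≗ (λ w → agree (profile (χ ∘ ρ) w) (τ ∘ ρ))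
      repeat χ w = cong (⌊ rel S (χ 0F) w ≟ τ 0F ⌋ ∧_)
        (let b = ⌊ rel S (χ 1F) w ≟ τ 1F ⌋ in
         sym (trans (sym (∧-assoc b b true)) (cong (_∧ true) (∧-idem b))))

    regular-2-3 : ∀ i → i < 2 → Regular (i ℕ.+ 2)
    regular-2-3 0 _ = regular₂
    regular-2-3 1 _ = regular₃
    regular-2-3 (suc (suc _)) (s≤s (s≤s ()))

  place-∼ : ∀ {j} {r₁ r₂ : Fin (suc (suc j))} (r₁≢r₂ : r₁ ≢ r₂) {χ χ′ : Fin j ⊎ Fin 2 → Fin n} →
            χ ∼ χ′ → place r₁≢r₂ χ ∼ place r₁≢r₂ χ′
  place-∼ r₁≢r₂ {χ} {χ′} = ∼-reindex (place r₁≢r₂ (λ a → a))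
    (place-natural r₁≢r₂ χ (λ a → a)) (place-natural r₁≢r₂ χ′ (λ a → a))

  scaffold-pinned : ∀ {j} (G : Digraph (suc (suc j))) {r₁ r₂} (r₁≢r₂ : r₁ ≢ r₂) w (ψ : Fin 2 → Fin n) →
                    scaffold G r₁ r₂ w (ψ 0F) (ψ 1F) ≈
                    ∑Maps j (λ φ → weight G w (place r₁≢r₂ [ φ , ψ ]))
  scaffold-pinned {j} G {r₁} {r₂} r₁≢r₂ w ψ =
    ≈-trans (∑Maps-pin (suc j) r₁ x off₁) (≈-trans (∑Maps-pin j r₂′ y off₂) (∑Maps-cong j on))
    where
    x = ψ 0F
    y = ψ 1F
    r₂′ = punchOut r₁≢r₂
    term : (Fin (suc (suc j)) → Fin n) → Carrier
    term φ = if ⌊ φ r₁ ≟ x ⌋ ∧ ⌊ φ r₂ ≟ y ⌋ then weight G w φ else 0#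
    off₁ : ∀ φ → φ r₁ ≢ x → term φ ≈ 0#
    off₁ φ φr₁≢x with φ r₁ ≟ x
    ... | yes φr₁≡x = ⊥-elim (φr₁≢x φr₁≡x)
    ... | no _      = ≈-refl
    off₂ : ∀ φ → φ r₂′ ≢ y → term (insert r₁ x φ) ≈ 0#
    off₂ φ φr₂′≢y with ⌊ insert r₁ x φ r₁ ≟ x ⌋ | insert r₁ x φ r₂ ≟ y
    ... | _     | yes e = ⊥-elim (φr₂′≢y (trans (sym (insert-punchOut r₁≢r₂ x φ)) e))
    ... | false | no _  = ≈-refl
    ... | true  | no _  = ≈-refl
    on : ∀ φ → term (insert r₁ x (insert r₂′ y φ)) ≈ weight G w (insert r₁ x (insert r₂′ y φ))
    on φ with insert r₁ x (insert r₂′ y φ) r₁ ≟ x | insert r₁ x (insert r₂′ y φ) r₂ ≟ y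
    ... | yes _    | yes _    = ≈-refl
    ... | no χr₁≢x | _        = ⊥-elim (χr₁≢x (insert-self r₁ x _))
    ... | yes _    | no χr₂≢y =
      ⊥-elim (χr₂≢y (trans (insert-punchOut r₁≢r₂ x _) (insert-self r₂′ y φ)))

  scaffold-InBM : TriplyRegular S → ∀ {j} → j ≤ 2 → (G : Digraph (suc (suc j))) →
                  {r₁ r₂ : Fin (suc (suc j))} → r₁ ≢ r₂ → ∀ w → (∀ e → InBM S (w e)) → InBM S (scaffold G r₁ r₂ w)
  scaffold-InBM triply {j} j≤2 G {r₁} {r₂} r₁≢r₂ w w∈BM = invariant⇒InBM λ {ψ} {ψ′} ψ∼ψ′ → begin
    scaffold G r₁ r₂ w (ψ 0F) (ψ 1F)                        ≈⟨ scaffold-pinned G r₁≢r₂ w ψ ⟩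
    ∑Maps j (λ φ → weight G w (place r₁≢r₂ [ φ , ψ ]))    ≈⟨ pinned-invariant ψ∼ψ′ ⟩
    ∑Maps j (λ φ → weight G w (place r₁≢r₂ [ φ , ψ′ ]))   ≈⟨ scaffold-pinned G r₁≢r₂ w ψ′ ⟨
    scaffold G r₁ r₂ w (ψ′ 0F) (ψ′ 1F)                      ∎
    where
    open ≈-Reasoning
    pinned-invariant : Invariant (λ ψ → ∑Maps j (λ φ → weight G w (place r₁≢r₂ [ φ , ψ ])))
    pinned-invariant = ∑Maps-invariant j (λ i i<j → regular-2-3 triply i (<-≤-trans i<j j≤2))
                                         (λ χ∼χ′ → weight-invariant G w∈BM (place-∼ r₁≢r₂ χ∼χ′))

proposition6p3 : ∀ {c ℓ : Level} (K : CommutativeRing c ℓ) {n d : ℕ}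
                   (S : SymAssocScheme n d) →
                   TriplyRegular S → OverRing.VertexCondition K 4 S
proposition6p3 K S triply zero          _               G ()  _  _
proposition6p3 K S triply (suc zero)    _               G 0F 0F r₁≢r₂ = ⊥-elim (r₁≢r₂ refl)
proposition6p3 K S triply (suc (suc j)) (s≤s (s≤s j≤2)) G r₁ r₂ r₁≢r₂ =
  Scheme.scaffold-InBM K S triply j≤2 G r₁≢r₂
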